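{- Let $a$ be a weak composition and $T\in\mathrm{KT}(a)$. Let $\theta(T)$ be the filling obtained from $T$ by replacing, for every thread of the thread decomposition of $T$, all entries of the cells in that thread by the row index of the thread's cell in column $1$. Then $\theta(T)$ is a quasi-Kohnert tableau (of content $c$, where $c_i$ is the number of cells of $\theta(T)$ with entry $i$).
   Context: A weak composition of length $n$ is $a=(a_1,\dots,a_n)$ with $a_i\in\mathbb{Z}_{\ge0}$. A diagram is a finite set of cells in $\mathbb{N}\times\mathbb{N}$ (row $r\ge1$, column $c\ge1$), rows indexed from the bottom. A Kohnert tableau of content $a$ is a diagram whose cells are filled, one entry per cell, with the multiset $1^{a_1},\dots,n^{a_n}$, such that: (i) for each $i$, there is exactly one entry $i$ in each of columns $1,\dots,a_i$; (ii) every entry in row $r$ is at least $r$; (iii) the cells with entry $i$ weakly descend from left to right; (iv) if $i<j$ appear in the same column with the $i$ above the $j$, then there is an $i$ in the column immediately to the right, in a row strictly above the row of that $j$. $\mathrm{KT}(a)$ is the set of these. A quasi-Kohnert tableau of content $c$ is a Kohnert tableau of content $c$ such that (v) the entries of column $1$ strictly increase from bottom to top, and (vi) whenever $i<j$ lie in consecutive columns with the $i$ in the left column and weakly above the $j$, $c_i\ge c_j$. The thread decomposition of (the diagram of) $T$ partitions its cells into threads: starting from the rightmost column containing a not-yet-threaded cell, begin a thread at the lowest not-yet-threaded cell of that column; after threading a cell in column $j+1$, add to the thread the lowest not-yet-threaded cell in column $j$ that is weakly above the threaded cell in column $j+1$; continue until all columns to the left are threaded or no such cell exists. Repeat until every cell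 belongs to a thread. (Every thread ends in column $1$.) -}

module Defs where

open import Data.Nat using (ℕ; zero; suc; _≤_; _<_; _≟_; _≤?_; pred; _⊔_)
open import Data.Nat.Properties using (≤-refl)
open import Data.Bool using (Bool; true; false; if_then_else_)
open import Data.Product using (_×_; _,_; proj₁; proj₂; ∃-syntax)
open import Data.Product.Properties using (≡-dec)
open import Data.Maybe using (Maybe; just; nothing)
open import Data.List using (List; []; _∷_; map; filter; length; upTo)
open import Data.List.Membership.Propositional using (_∈_)
open import Data.List.Relation.Unary.All using (All)
open import Data.List.Relation.Unary.Unique.Propositional using (Unique)
open import Relation.Nullary using (¬_; yes; no)
open import Relation.Nullary.Decidable using (¬?; _×-dec_)
open import Relation.Binary.PropositionalEquality using (_≡_)
import Data.List.Membership.DecPropositional as DecMem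

-- A position is (row , column); rows indexed from the bottom, both ≥ 1.
Pos : Set
Pos = ℕ × ℕ

prow : Pos → ℕ
prow = proj₁

pcol : Pos → ℕ
pcol = proj₂

record Cell : Set where
  constructor cell
  field
    row : ℕ
    col : ℕ
    ent : ℕ
open Cell public

pos : Cell → Pos
pos x = row x , col x

-- A filling of a diagram: a list of filled cells (positions distinct,
-- enforced in the tableau predicates below).
Filling : Set
Filling = List Cell

-- 1-indexed access to a weak composition a = (a_1,...,a_n) (given as a
-- list of length n); value 0 outside 1..n (never used there, since the
-- tableau conditions force all entries to lie in 1..n).
at : List ℕ → ℕ → ℕ
at []       _             = 0
at (x ∷ xs) zero          = 0
at (x ∷ xs) (suc zero)    = x
at (x ∷ xs) (suc (suc i)) = at xs (suc i)

record IsKT (a : List ℕ) (T : Filling) : Set where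
  field
    distinct  : Unique (map pos T)
    positive  : All (λ x → 1 ≤ row x × 1 ≤ col x) T
    -- the entries form the multiset 1^{a_1} ... n^{a_n}: every entry is in
    -- 1..n, and (with condition (i) below) entry i occurs exactly a_i times
    entRange  : All (λ x → 1 ≤ ent x × ent x ≤ length a) T
    cond-i-ex   : ∀ i k → 1 ≤ i → i ≤ length a → 1 ≤ k → k ≤ at a i →
                  ∃[ x ] (x ∈ T × ent x ≡ i × col x ≡ k)
    cond-i-uniq : ∀ x y → x ∈ T → y ∈ T → ent x ≡ ent y → col x ≡ col y → x ≡ y
    cond-i-none : ∀ x → x ∈ T → col x ≤ at a (ent x)
    cond-ii   : All (λ x → row x ≤ ent x) T
    cond-iii  : ∀ x y → x ∈ T → y ∈ T → ent x ≡ ent y → col x < col y → row y ≤ row x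
    cond-iv   : ∀ x y → x ∈ T → y ∈ T → col x ≡ col y → ent x < ent y → row y < row x →
                ∃[ z ] (z ∈ T × ent z ≡ ent x × col z ≡ suc (col x) × row y < row z)

record IsQKT (c : List ℕ) (T : Filling) : Set where
  field
    isKT   : IsKT c T
    cond-v  : ∀ x y → x ∈ T → y ∈ T → col x ≡ 1 → col y ≡ 1 → row x < row y → ent x < ent y
    cond-vi : ∀ x y → x ∈ T → y ∈ T → ent x < ent y → col y ≡ suc (col x) → row y ≤ row x →
              at c (ent y) ≤ at c (ent x)

open DecMem (≡-dec _≟_ _≟_) using (_∈?_)

lowest : List Pos → Maybe Pos
lowest [] = nothing
lowest (p ∷ ps) with lowest ps
... | nothing = just p
... | just q with prow p ≤? prow q
...   | yes _ = just p
...   | no  _ = just q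

maxCol : List Pos → ℕ
maxCol [] = 0
maxCol (p ∷ ps) = pcol p ⊔ maxCol ps

candidates : ℕ → ℕ → List Pos → List Pos
candidates j r U = filter (λ p → (pcol p ≟ j) ×-dec (r ≤? prow p)) U

-- continue a thread leftwards: 'walk j cur U' looks in column j for the
-- lowest unthreaded cell weakly above 'cur' (which sits in column j+1),
-- and continues to columns j-1, ..., 1; stops if no such cell exists.
walk : ℕ → Pos → List Pos → List Pos
walk zero    cur U = []
walk (suc j) cur U with lowest (candidates (suc j) (prow cur) U)
... | nothing = []
... | just p  = p ∷ walk j p U

removeAll : List Pos → List Pos → List Pos
removeAll t U = filter (λ p → ¬? (p ∈? t)) U

-- threads of the set U of not-yet-threaded cells (fuel = number of cells)
threadsF : ℕ → List Pos → List (List Pos)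
threadsF zero    U = []
threadsF (suc f) U with lowest (filter (λ p → pcol p ≟ maxCol U) U)
... | nothing = []
... | just s  = let t = s ∷ walk (pred (pcol s)) s U
                in t ∷ threadsF f (removeAll t U)

threads : List Pos → List (List Pos)
threads D = threadsF (length D) D

-- row of the column-1 cell of a thread (0 if it had none; by the paper
-- every thread of a Kohnert tableau ends in column 1)
col1Row : List Pos → ℕ
col1Row [] = 0
col1Row (p ∷ ps) with pcol p ≟ 1
... | yes _ = prow p
... | no  _ = col1Row ps

label : List (List Pos) → Pos → ℕ
label [] p = 0
label (t ∷ ts) p with p ∈? t
... | yes _ = col1Row t
... | no  _ = label ts p

θ : Filling → Filling
θ T = map (λ x → cell (row x) (col x) (label ths (pos x))) T
  where ths = threads (map pos T)

countEnt : ℕ → Filling → ℕ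
countEnt i S = length (filter (λ x → ent x ≟ i) S)

contentOf : ℕ → Filling → List ℕ
contentOf n S = map (λ k → countEnt (suc k) S) (upTo n)

-- Threads are built greedily: each moves one column left to the lowest unthreaded cell weakly
-- above its previous cell. Conditions (i) and (iii) give a Hall-type inequality (every column has
-- at least as many cells weakly above any row as the column to its right), which forces every walk
-- to reach column 1 and survives the removal of a thread. Hence each thread has exactly one cell in
-- each column up to its starting column and descends weakly to the right; and threads do not
-- cross: a thread that passes strictly below a later-cut thread in some column stays strictly
-- below it in every column to the left. In θ(T) each thread becomes the set of cells of a
-- single entry, the row of its column-1 cell, occurring once per column of the thread; conditions
-- (iv) and (vi) then come from the non-crossing of threads, and (v) from the distinct rows of the
-- column-1 cells.

module Submission where

open import Defs
open import Data.Nat using (ℕ; zero; suc; _≤_; _<_; z≤n; s≤s; _≟_; _≤?_; pred; _∸_; _+_)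
open import Data.Nat.Properties
  using ( ≤-refl; ≤-trans; ≤-antisym; <-≤-trans; ≤-<-trans; <⇒≤; ≰⇒>; <-irrefl; <-asym; <⇒≢
        ; n≤1+n; m≤n⇒m≤1+n; ≤-pred; suc-injective; m≤n⇒m<n∨m≡n; m≤m⊔n; m≤n⊔m; ⊔-sel
        ; ⊔-identityʳ; m≤n+m; m∸n+n≡m; <⇒≱; 1+n≢n; ≤-reflexive; ≤∧≢⇒<)
open import Data.Product using (_×_; _,_; proj₁; proj₂; ∃-syntax; Σ)
open import Data.Product.Properties using (≡-dec)
open import Data.Sum using (_⊎_; inj₁; inj₂)
open import Data.Maybe using (just; nothing)
open import Data.List using (List; []; _∷_; map; filter; length; applyUpTo; upTo)
open import Data.List.Properties using (filter-notAll; length-map; map-∘; length-applyUpTo)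
open import Data.List.Membership.Propositional using (_∈_; _∉_; lose)
open import Data.List.Membership.Propositional.Properties
  using (∈-filter⁺; ∈-filter⁻; ∈-map⁺; ∈-map⁻; ∈-applyUpTo⁺; ∈-applyUpTo⁻)
open import Data.List.Relation.Unary.Any using (here; there)
import Data.List.Relation.Unary.All as All
import Data.List.Relation.Unary.All.Properties as All
open import Data.List.Relation.Unary.Unique.Propositional using (Unique)
open import Data.List.Relation.Unary.AllPairs using ([]; _∷_)
import Data.List.Relation.Unary.Unique.Propositional.Properties as Unique
open import Data.Empty using (⊥; ⊥-elim)
open import Level using (0ℓ)
open import Relation.Nullary using (¬_; yes; no)
open import Relation.Nullary.Decidable using (¬?; _×-dec_)
open import Relation.Unary using (Pred; Decidable)
open import Relation.Binary.Definitions using (DecidableEquality)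
open import Relation.Binary.PropositionalEquality
  using (_≡_; _≢_; refl; sym; trans; cong; subst; subst₂)
import Data.List.Membership.DecPropositional as DecMembership

suc-pred-≥1 : ∀ {n} → 1 ≤ n → suc (pred n) ≡ n
suc-pred-≥1 (s≤s _) = refl

∈-of-length≥1 : ∀ {A : Set} {xs : List A} → 1 ≤ length xs → ∃[ x ] (x ∈ xs)
∈-of-length≥1 {xs = x ∷ _} _ = x , here refl

module _ {A : Set} where

  count : {P : Pred A 0ℓ} → Decidable P → List A → ℕ
  count P? [] = 0
  count P? (x ∷ xs) with P? x
  ... | yes _ = suc (count P? xs)
  ... | no _  = count P? xs

  module _ {P Q : Pred A 0ℓ} (P? : Decidable P) (Q? : Decidable Q) where

    count-mono : ∀ xs → (∀ {x} → x ∈ xs → P x → Q x) → count P? xs ≤ count Q? xs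
    count-mono [] P⇒Q = z≤n
    count-mono (x ∷ xs) P⇒Q with P? x | Q? x
    ... | yes _ | yes _ = s≤s (count-mono xs (λ m → P⇒Q (there m)))
    ... | yes p | no ¬q = ⊥-elim (¬q (P⇒Q (here refl) p))
    ... | no _  | yes _ = m≤n⇒m≤1+n (count-mono xs (λ m → P⇒Q (there m)))
    ... | no _  | no _  = count-mono xs (λ m → P⇒Q (there m))

    count-< : ∀ xs → (∀ {x} → x ∈ xs → P x → Q x) →
              ∀ {y} → y ∈ xs → Q y → ¬ P y → count P? xs < count Q? xs
    count-< (x ∷ xs) P⇒Q (here refl) qy ¬py with P? x | Q? x
    ... | yes py | _     = ⊥-elim (¬py py)
    ... | no _   | no ¬q = ⊥-elim (¬q qy)
    ... | no _   | yes _ = s≤s (count-mono xs (λ m → P⇒Q (there m)))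
    count-< (x ∷ xs) P⇒Q (there y∈) qy ¬py with P? x | Q? x
    ... | yes _ | yes _ = s≤s (count-< xs (λ m → P⇒Q (there m)) y∈ qy ¬py)
    ... | yes p | no ¬q = ⊥-elim (¬q (P⇒Q (here refl) p))
    ... | no _  | yes _ = m≤n⇒m≤1+n (count-< xs (λ m → P⇒Q (there m)) y∈ qy ¬py)
    ... | no _  | no _  = count-< xs (λ m → P⇒Q (there m)) y∈ qy ¬py

    count-filter : ∀ xs → count P? (filter Q? xs) ≡ count (λ x → P? x ×-dec Q? x) xs
    count-filter [] = refl
    count-filter (x ∷ xs) with Q? x
    ... | no _ with P? x
    ...   | yes _ = count-filter xs
    ...   | no _  = count-filter xs
    count-filter (x ∷ xs) | yes _ with P? x
    ...   | yes _ = cong suc (count-filter xs)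
    ...   | no _  = count-filter xs

  count-cong : {P Q : Pred A 0ℓ} (P? : Decidable P) (Q? : Decidable Q) →
               ∀ xs → (∀ {x} → x ∈ xs → P x → Q x) → (∀ {x} → x ∈ xs → Q x → P x) →
               count P? xs ≡ count Q? xs
  count-cong P? Q? xs P⇒Q Q⇒P = ≤-antisym (count-mono P? Q? xs P⇒Q) (count-mono Q? P? xs Q⇒P)

  module _ {P : Pred A 0ℓ} (P? : Decidable P) where

    count-≡0 : ∀ xs → (∀ {x} → x ∈ xs → ¬ P x) → count P? xs ≡ 0
    count-≡0 [] _ = refl
    count-≡0 (x ∷ xs) ¬P with P? x
    ... | yes p = ⊥-elim (¬P (here refl) p)
    ... | no _  = count-≡0 xs (λ m → ¬P (there m))

    count-positive : ∀ {xs y} → y ∈ xs → P y → 0 < count P? xs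
    count-positive {x ∷ xs} (here refl) py with P? x
    ... | yes _ = s≤s z≤n
    ... | no ¬p = ⊥-elim (¬p py)
    count-positive {x ∷ xs} (there y∈) py with P? x
    ... | yes _ = s≤s z≤n
    ... | no _  = count-positive y∈ py

    count-witness : ∀ xs → 0 < count P? xs → ∃[ y ] (y ∈ xs × P y)
    count-witness (x ∷ xs) pos with P? x
    ... | yes p = x , here refl , p
    ... | no _ with y , y∈ , py ← count-witness xs pos = y , there y∈ , py

    count≡length-filter : ∀ xs → count P? xs ≡ length (filter P? xs)
    count≡length-filter [] = refl
    count≡length-filter (x ∷ xs) with P? x
    ... | yes _ = cong suc (count≡length-filter xs)
    ... | no _  = count≡length-filter xs

  module _ (_≟ₐ_ : DecidableEquality A) where

    count-remove : {P : Pred A 0ℓ} (P? : Decidable P) → ∀ {xs} → Unique xs → ∀ {y} → y ∈ xs → P y →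
                   count P? xs ≡ suc (count (λ x → P? x ×-dec ¬? (x ≟ₐ y)) xs)
    count-remove P? {x ∷ xs} (x∉ ∷ _) (here refl) py with P? x | x ≟ₐ x
    ... | no ¬p | _      = ⊥-elim (¬p py)
    ... | yes _ | no x≢x = ⊥-elim (x≢x refl)
    ... | yes _ | yes _  =
      cong suc (count-cong P? _ xs (λ m p → p , λ e → All.lookup x∉ m (sym e)) (λ _ → proj₁))
    count-remove P? {x ∷ xs} (x∉ ∷ u) {y} (there y∈) py with P? x | x ≟ₐ y
    ... | yes _ | yes refl = ⊥-elim (All.lookup x∉ y∈ refl)
    ... | yes _ | no _     = cong suc (count-remove P? u y∈ py)
    ... | no _  | _        = count-remove P? u y∈ py

    Unique⇒length-≤ : ∀ {xs ys} → Unique xs → (∀ {x} → x ∈ xs → x ∈ ys) → length xs ≤ length ys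
    Unique⇒length-≤ {[]} _ _ = z≤n
    Unique⇒length-≤ {x ∷ xs} {ys} (x∉ ∷ u) xs⊆ys =
      ≤-trans (s≤s (Unique⇒length-≤ u xs⊆ys-x))
              (filter-notAll ≢x? ys (lose (xs⊆ys (here refl)) (λ x≢x → x≢x refl)))
      where
        ≢x? = λ y → ¬? (y ≟ₐ x)
        xs⊆ys-x : ∀ {z} → z ∈ xs → z ∈ filter ≢x? ys
        xs⊆ys-x z∈ = ∈-filter⁺ ≢x? (xs⊆ys (there z∈)) (λ e → All.lookup x∉ z∈ (sym e))

module _ {A B : Set} where

  count-map : {P : Pred B 0ℓ} (P? : Decidable P) (f : A → B) →
              ∀ xs → count P? (map f xs) ≡ count (λ x → P? (f x)) xs
  count-map P? f [] = refl
  count-map P? f (x ∷ xs) with P? (f x)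
  ... | yes _ = cong suc (count-map P? f xs)
  ... | no _  = count-map P? f xs

  Unique-map-injectiveOn : (f : A → B) → ∀ {xs} → Unique xs →
                           (∀ {x y} → x ∈ xs → y ∈ xs → f x ≡ f y → x ≡ y) → Unique (map f xs)
  Unique-map-injectiveOn f {[]} [] _ = []
  Unique-map-injectiveOn f {x ∷ xs} (x∉ ∷ u) inj =
    All.map⁺ (All.tabulate (λ y∈ e → All.lookup x∉ y∈ (inj (here refl) (there y∈) e)))
    ∷ Unique-map-injectiveOn f u (λ x∈ y∈ → inj (there x∈) (there y∈))

module _ {A B : Set} (_≟ᵦ_ : DecidableEquality B) (key : A → B) where

  count-≤-matching : {P Q : Pred A 0ℓ} (P? : Decidable P) (Q? : Decidable Q) → ∀ {xs} → Unique xs →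
                     (∀ {x y} → x ∈ xs → y ∈ xs → P x → P y → key x ≡ key y → x ≡ y) →
                     (∀ {x} → x ∈ xs → P x → ∃[ y ] (y ∈ xs × Q y × key y ≡ key x)) →
                     count P? xs ≤ count Q? xs
  count-≤-matching P? Q? {xs} u key-injective match =
    subst₂ _≤_ (trans (length-map key (filter P? xs)) (sym (count≡length-filter P? xs)))
               (trans (length-map key (filter Q? xs)) (sym (count≡length-filter Q? xs)))
               (Unique⇒length-≤ _≟ᵦ_ unique-keys keys⊆)
    where
      unique-keys : Unique (map key (filter P? xs))
      unique-keys = Unique-map-injectiveOn key (Unique.filter⁺ P? u) λ x∈ y∈ →
        let x∈xs , px = ∈-filter⁻ P? {xs = xs} x∈ ; y∈xs , py = ∈-filter⁻ P? {xs = xs} y∈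
        in key-injective x∈xs y∈xs px py
      keys⊆ : ∀ {k} → k ∈ map key (filter P? xs) → k ∈ map key (filter Q? xs)
      keys⊆ k∈ with x , x∈ , refl ← ∈-map⁻ key k∈
               with x∈xs , px ← ∈-filter⁻ P? {xs = xs} x∈
               with y , y∈ , qy , ky≡kx ← match x∈xs px
        = subst (_∈ map key (filter Q? xs)) ky≡kx (∈-map⁺ key (∈-filter⁺ Q? y∈ qy))

length≡-range : ∀ {L : List ℕ} {s} → Unique L → (∀ {c} → c ∈ L → 1 ≤ c × c ≤ s) →
                (∀ c → 1 ≤ c → c ≤ s → c ∈ L) → length L ≡ s
length≡-range {L} {s} u ⊆range range⊆ = ≤-antisym
  (subst (length L ≤_) (length-applyUpTo suc s) (Unique⇒length-≤ _≟_ u (λ c∈ → in-range (⊆range c∈))))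
  (subst (_≤ length L) (length-applyUpTo suc s)
         (Unique⇒length-≤ _≟_ range-unique (λ c∈ → out-of-range (∈-applyUpTo⁻ suc c∈))))
  where
    in-range : ∀ {c} → 1 ≤ c × c ≤ s → c ∈ applyUpTo suc s
    in-range (s≤s _ , c≤s) = ∈-applyUpTo⁺ suc c≤s
    out-of-range : ∀ {c} → ∃[ i ] (i < s × c ≡ suc i) → c ∈ L
    out-of-range (i , i<s , refl) = range⊆ (suc i) (s≤s z≤n) i<s
    range-unique : Unique (applyUpTo suc s)
    range-unique = Unique.applyUpTo⁺₁ suc s (λ i<j _ e → <⇒≢ i<j (suc-injective e))

-- Greedy walks and the Hall condition

open DecMembership (≡-dec _≟_ _≟_) using (_∈?_)

_≟ₚ_ : DecidableEquality Pos
_≟ₚ_ = ≡-dec _≟_ _≟_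

≡-Pos : ∀ {p q : Pos} → prow p ≡ prow q → pcol p ≡ pcol q → p ≡ q
≡-Pos {_ , _} {_ , _} refl refl = refl

lowest-just : ∀ ps {q} → q ∈ ps → ∃[ p ] (lowest ps ≡ just p)
lowest-just (x ∷ ps) _ with lowest ps
... | nothing = x , refl
... | just q with prow x ≤? prow q
...   | yes _ = x , refl
...   | no _  = q , refl

lowest-nothing : ∀ ps {q} → lowest ps ≡ nothing → q ∉ ps
lowest-nothing ps eq q∈ with _ , eq′ ← lowest-just ps q∈ with () ← trans (sym eq) eq′

lowest-minimal : ∀ ps {p} → lowest ps ≡ just p → p ∈ ps × (∀ {q} → q ∈ ps → prow p ≤ prow q)
lowest-minimal (x ∷ ps) eq with lowest ps in eq-ps
lowest-minimal (x ∷ ps) refl | nothing =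
  here refl , λ { (here refl) → ≤-refl ; (there q∈) → ⊥-elim (lowest-nothing ps eq-ps q∈) }
... | just q with prow x ≤? prow q | lowest-minimal ps eq-ps
lowest-minimal (x ∷ ps) refl | just q | yes x≤q | _ , q-min =
  here refl , λ { (here refl) → ≤-refl ; (there m) → ≤-trans x≤q (q-min m) }
lowest-minimal (x ∷ ps) refl | just q | no x≰q | q∈ , q-min =
  there q∈ , λ { (here refl) → <⇒≤ (≰⇒> x≰q) ; (there m) → q-min m }

maxCol-upperBound : ∀ U {p} → p ∈ U → pcol p ≤ maxCol U
maxCol-upperBound (x ∷ U) (here refl) = m≤m⊔n _ _
maxCol-upperBound (x ∷ U) (there p∈) = ≤-trans (maxCol-upperBound U p∈) (m≤n⊔m _ _)

maxCol-attained : ∀ U {q} → q ∈ U → ∃[ p ] (p ∈ U × pcol p ≡ maxCol U)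
maxCol-attained (x ∷ U) _ = attained x U
  where
    attained : ∀ x U → ∃[ p ] (p ∈ x ∷ U × pcol p ≡ maxCol (x ∷ U))
    attained x [] = x , here refl , sym (⊔-identityʳ _)
    attained x (y ∷ ys) with ⊔-sel (pcol x) (maxCol (y ∷ ys))
    ... | inj₁ e = x , here refl , sym e
    ... | inj₂ e with p , p∈ , pc ← attained y ys = p , there p∈ , trans pc (sym e)

Candidate : ℕ → ℕ → Pos → Set
Candidate c r p = pcol p ≡ c × r ≤ prow p

candidate? : ∀ c r → Decidable (Candidate c r)
candidate? c r p = (pcol p ≟ c) ×-dec (r ≤? prow p)

Hall : List Pos → Set
Hall U = ∀ j r → 1 ≤ j → count (candidate? (suc j) r) U ≤ count (candidate? j r) U

LowestAbove : List Pos → Pos → Pos → Set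
LowestAbove U p q =
  prow q ≤ prow p × (∀ {u} → u ∈ U → pcol u ≡ pcol p → prow q ≤ prow u → prow p ≤ prow u)

record IsChain (U : List Pos) (j : ℕ) (W : List Pos) : Set where
  field
    ⊆U            : ∀ {p} → p ∈ W → p ∈ U
    col-bounds    : ∀ {p} → p ∈ W → 1 ≤ pcol p × pcol p ≤ j
    cover         : ∀ c → 1 ≤ c → c ≤ j → ∃[ p ] (p ∈ W × pcol p ≡ c)
    col-injective : ∀ {p q} → p ∈ W → q ∈ W → pcol p ≡ pcol q → p ≡ q
    lowestAbove   : ∀ {p q} → p ∈ W → q ∈ W → pcol q ≡ suc (pcol p) → LowestAbove U p q

  beyond-bound : ∀ {p} → p ∈ W → j < pcol p → ⊥
  beyond-bound p∈ j<p = <⇒≱ j<p (proj₂ (col-bounds p∈))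

open IsChain

chain-[] : ∀ {U} → IsChain U 0 []
chain-[] = record
  { ⊆U = λ () ; col-bounds = λ () ; cover = λ { c (s≤s _) () }
  ; col-injective = λ () ; lowestAbove = λ () }

chain-∷ : ∀ {U j W p} → IsChain U j W → p ∈ U → pcol p ≡ suc j →
          (∀ {q} → q ∈ W → pcol q ≡ j → LowestAbove U q p) → IsChain U (suc j) (p ∷ W)
chain-∷ {U} {j} {W} {p} W-chain p∈ pc link = record
  { ⊆U = λ { (here refl) → p∈ ; (there q∈) → ⊆U W-chain q∈ }
  ; col-bounds = λ { (here refl) → subst (1 ≤_) (sym pc) (s≤s z≤n) , subst (_≤ suc j) (sym pc) ≤-refl
                   ; (there q∈) → let 1≤q , q≤j = col-bounds W-chain q∈ in 1≤q , m≤n⇒m≤1+n q≤j }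
  ; cover = cover′ ; col-injective = injective ; lowestAbove = lowestAbove′ }
  where
    cover′ : ∀ c → 1 ≤ c → c ≤ suc j → ∃[ q ] (q ∈ p ∷ W × pcol q ≡ c)
    cover′ c 1≤c c≤1+j with c ≟ suc j
    ... | yes refl = p , here refl , pc
    ... | no c≢1+j with q , q∈ , qc ← cover W-chain c 1≤c (≤-pred (≤∧≢⇒< c≤1+j c≢1+j))
      = q , there q∈ , qc
    injective : ∀ {q q′} → q ∈ p ∷ W → q′ ∈ p ∷ W → pcol q ≡ pcol q′ → q ≡ q′
    injective (here refl) (here refl) _  = refl
    injective (here refl) (there q∈) e = ⊥-elim (beyond-bound W-chain q∈ (≤-reflexive (trans (sym pc) e)))
    injective (there q∈) (here refl) e = ⊥-elim (beyond-bound W-chain q∈ (≤-reflexive (trans (sym pc) (sym e))))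
    injective (there q∈) (there q′∈) e = col-injective W-chain q∈ q′∈ e
    lowestAbove′ : ∀ {q q′} → q ∈ p ∷ W → q′ ∈ p ∷ W → pcol q′ ≡ suc (pcol q) → LowestAbove U q q′
    lowestAbove′ (here refl) (here refl) e   = ⊥-elim (1+n≢n (sym e))
    lowestAbove′ (here refl) (there q′∈) e  =
      ⊥-elim (beyond-bound W-chain q′∈ (≤-trans (n≤1+n _) (≤-reflexive (sym (trans e (cong suc pc))))))
    lowestAbove′ (there q∈) (here refl) e   = link q∈ (suc-injective (trans (sym e) pc))
    lowestAbove′ (there q∈) (there q′∈) e  = lowestAbove W-chain q∈ q′∈ e

hall-candidate : ∀ {U} → Hall U → ∀ {j cur} → cur ∈ U → pcol cur ≡ suc (suc j) →
                 ∃[ p ] (p ∈ U × Candidate (suc j) (prow cur) p)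
hall-candidate {U} H {j} {cur} cur∈ cc =
  count-witness (candidate? (suc j) (prow cur)) U
    (≤-trans (count-positive (candidate? (suc (suc j)) (prow cur)) cur∈ (cc , ≤-refl))
             (H (suc j) (prow cur) (s≤s z≤n)))

walk-chain : ∀ {U} → Hall U → ∀ j {cur} → cur ∈ U → pcol cur ≡ suc j →
             IsChain U j (walk j cur U) × (∀ {p} → p ∈ walk j cur U → pcol p ≡ j → LowestAbove U p cur)
walk-chain H zero _ _ = chain-[] , λ ()
walk-chain {U} H (suc j) {cur} cur∈ cc with lowest (candidates (suc j) (prow cur) U) in eq
... | nothing with p , p∈ , p-cand ← hall-candidate H cur∈ cc
  = ⊥-elim (lowest-nothing _ eq (∈-filter⁺ (candidate? (suc j) (prow cur)) p∈ p-cand))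
... | just p with p∈c , p-min ← lowest-minimal _ eq
  with p∈ , pc , cur≤p ← ∈-filter⁻ (candidate? (suc j) (prow cur)) {xs = U} p∈c
  with W-chain , W-link ← walk-chain H j p∈ pc
  = chain-∷ W-chain p∈ pc W-link , link
  where
    link : ∀ {q} → q ∈ p ∷ walk j p U → pcol q ≡ suc j → LowestAbove U q cur
    link (here refl) _ =
      cur≤p , λ u∈ uc cur≤u → p-min (∈-filter⁺ (candidate? (suc j) (prow cur)) u∈ (trans uc pc , cur≤u))
    link (there q∈) qc = ⊥-elim (beyond-bound W-chain q∈ (≤-reflexive (sym qc)))

record IsThread (U t : List Pos) : Set where
  field
    start        : Pos
    start∈       : start ∈ t
    chain        : IsChain U (pcol start) t
    start-max    : ∀ {u} → u ∈ U → pcol u ≤ pcol start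
    start-lowest : ∀ {u} → u ∈ U → pcol u ≡ pcol start → prow start ≤ prow u

open IsThread

thread-from : ∀ {U} → Hall U → ∀ {s} → s ∈ U → 1 ≤ pcol s →
              (∀ {u} → u ∈ U → pcol u ≤ pcol s) →
              (∀ {u} → u ∈ U → pcol u ≡ pcol s → prow s ≤ prow u) →
              IsThread U (s ∷ walk (pred (pcol s)) s U)
thread-from {U} H {s} s∈ 1≤s s-max s-lowest = record
  { start = s ; start∈ = here refl
  ; chain = subst (λ k → IsChain U k (s ∷ W)) (suc-pred-≥1 1≤s) (chain-∷ W-chain s∈ sc W-link)
  ; start-max = s-max ; start-lowest = s-lowest }
  where
    sc = sym (suc-pred-≥1 1≤s)
    W = walk (pred (pcol s)) s U
    W-chain = proj₁ (walk-chain H (pred (pcol s)) s∈ sc)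
    W-link = proj₂ (walk-chain H (pred (pcol s)) s∈ sc)

record Threadable (U : List Pos) : Set where
  field
    unique : Unique U
    col≥1  : ∀ {p} → p ∈ U → 1 ≤ pcol p
    hall   : Hall U

open Threadable

module _ {U t : List Pos} (U-ok : Threadable U) (t-thread : IsThread U t) where

  private
    C = chain t-thread
    notIn? = λ p → ¬? (p ∈? t)
    U′ = removeAll t U

  count-removeAll : ∀ c r {p} → p ∈ t → pcol p ≡ c →
                    count (candidate? c r) U′ ≡ count (λ x → candidate? c r x ×-dec ¬? (x ≟ₚ p)) U
  count-removeAll c r {p} p∈ pc = trans (count-filter (candidate? c r) notIn? U)
    (count-cong _ _ U (λ _ (cand , x∉) → cand , λ x≡p → x∉ (subst (_∈ t) (sym x≡p) p∈))
                      (λ _ (cand , x≢p) → cand , λ x∈ →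
                                 x≢p (col-injective C x∈ p∈ (trans (proj₁ cand) (sym pc)))))

  count-removeAll-above : ∀ c r {p} → p ∈ t → pcol p ≡ c → r ≤ prow p →
                          count (candidate? c r) U ≡ suc (count (candidate? c r) U′)
  count-removeAll-above c r p∈ pc r≤p =
    trans (count-remove _≟ₚ_ (candidate? c r) (unique U-ok) (⊆U C p∈) (pc , r≤p))
          (cong suc (sym (count-removeAll c r p∈ pc)))

  count-removeAll-below : ∀ c r {p} → p ∈ t → pcol p ≡ c → ¬ r ≤ prow p →
                          count (candidate? c r) U ≡ count (candidate? c r) U′
  count-removeAll-below c r p∈ pc r≰p =
    trans (count-cong _ _ U (λ _ cand → cand , λ { refl → r≰p (proj₂ cand) }) (λ _ → proj₁))
          (sym (count-removeAll c r p∈ pc))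

  count-removeAll-beyond : ∀ c r → pcol (start t-thread) < c → count (candidate? c r) U′ ≡ 0
  count-removeAll-beyond c r s<c = count-≡0 (candidate? c r) U′
    (λ x∈ cand → <-irrefl (proj₁ cand) (≤-<-trans (start-max t-thread (proj₁ (∈-filter⁻ notIn? x∈))) s<c))

  -- In the one delicate case the thread's cell p₁ in column j+1 lies below r while its cell p₀
  -- in column j does not; then column j has no cell in the rows [row p₁, r), p₀ being the lowest
  -- cell above p₁, and Hall at height row p₁ gives the strict inequality needed.
  removeAll-hall : Hall U′
  removeAll-hall j r 1≤j with suc j ≤? pcol (start t-thread)
  ... | no 1+j≰s =
    subst (_≤ count (candidate? j r) U′) (sym (count-removeAll-beyond (suc j) r (≰⇒> 1+j≰s))) z≤n
  ... | yes 1+j≤s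
    with p₁ , p₁∈ , p₁c ← cover C (suc j) (s≤s z≤n) 1+j≤s
       | p₀ , p₀∈ , p₀c ← cover C j 1≤j (≤-trans (n≤1+n j) 1+j≤s)
    with p₁≤p₀ , p₀-lowest ← lowestAbove C p₀∈ p₁∈ (trans p₁c (cong suc (sym p₀c)))
    with r ≤? prow p₁ | r ≤? prow p₀
  ... | yes r≤p₁ | _ = ≤-pred (subst₂ _≤_ (count-removeAll-above (suc j) r p₁∈ p₁c r≤p₁)
                                          (count-removeAll-above j r p₀∈ p₀c (≤-trans r≤p₁ p₁≤p₀))
                                          (hall U-ok j r 1≤j))
  ... | no r≰p₁ | no r≰p₀ = subst₂ _≤_ (count-removeAll-below (suc j) r p₁∈ p₁c r≰p₁)
                                       (count-removeAll-below j r p₀∈ p₀c r≰p₀)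
                                       (hall U-ok j r 1≤j)
  ... | no r≰p₁ | yes r≤p₀ = ≤-pred (subst₂ _≤_ (cong suc (count-removeAll-below (suc j) r p₁∈ p₁c r≰p₁))
                                                (count-removeAll-above j r p₀∈ p₀c r≤p₀) strict)
    where
      p₁<r = ≰⇒> r≰p₁
      above-r⇒above-p₁ : ∀ c {x} → Candidate c r x → Candidate c (prow p₁) x
      above-r⇒above-p₁ c (xc , r≤x) = xc , <⇒≤ (<-≤-trans p₁<r r≤x)
      above-p₁⇒above-r : ∀ {x} → x ∈ U → Candidate j (prow p₁) x → Candidate j r x
      above-p₁⇒above-r x∈ (xc , p₁≤x) = xc , ≤-trans r≤p₀ (p₀-lowest x∈ (trans xc (sym p₀c)) p₁≤x)
      strict : count (candidate? (suc j) r) U < count (candidate? j r) U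
      strict = <-≤-trans
        (count-< (candidate? (suc j) r) (candidate? (suc j) (prow p₁)) U (λ _ → above-r⇒above-p₁ (suc j))
                 (⊆U C p₁∈) (p₁c , ≤-refl) (λ (_ , r≤p₁) → r≰p₁ r≤p₁))
        (≤-trans (hall U-ok j (prow p₁) 1≤j)
                 (≤-reflexive (count-cong _ _ U above-p₁⇒above-r (λ _ → above-r⇒above-p₁ j))))

  removeAll-threadable : Threadable U′
  removeAll-threadable = record
    { unique = Unique.filter⁺ notIn? (unique U-ok)
    ; col≥1 = λ p∈ → col≥1 U-ok (proj₁ (∈-filter⁻ notIn? p∈))
    ; hall = removeAll-hall }

-- The thread decomposition

label-∷-∈ : ∀ t ts {p} → p ∈ t → label (t ∷ ts) p ≡ col1Row t
label-∷-∈ t ts {p} p∈ with p ∈? t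
... | yes _  = refl
... | no p∉ = ⊥-elim (p∉ p∈)

label-∷-∉ : ∀ t ts {p} → p ∉ t → label (t ∷ ts) p ≡ label ts p
label-∷-∉ t ts {p} p∉ with p ∈? t
... | yes p∈ = ⊥-elim (p∉ p∈)
... | no _   = refl

-- X was cut out as a thread of a set V of cells that still contained all of Y.
Precedes : List Pos → List Pos → Set
Precedes X Y = Σ (List Pos) λ V → IsThread V X × (∀ {y} → y ∈ Y → y ∈ V) × (∀ {y} → y ∈ Y → y ∉ X)

record IsDecomposition (U : List Pos) (ths : List (List Pos)) : Set where
  field
    covers     : ∀ {p} → p ∈ U → ∃[ t ] (t ∈ ths × p ∈ t)
    thread     : ∀ {t} → t ∈ ths → Σ (List Pos) λ V → IsThread V t × (∀ {p} → p ∈ V → p ∈ U)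
    label-∈    : ∀ {t p} → t ∈ ths → p ∈ t → label ths p ≡ col1Row t
    trichotomy : ∀ {t t′} → t ∈ ths → t′ ∈ ths → t ≡ t′ ⊎ Precedes t t′ ⊎ Precedes t′ t

open IsDecomposition

decomposition-[] : IsDecomposition [] []
decomposition-[] = record { covers = λ () ; thread = λ () ; label-∈ = λ () ; trichotomy = λ () }

decomposition-∷ : ∀ {U t ths} → IsThread U t → IsDecomposition (removeAll t U) ths →
                  IsDecomposition U (t ∷ ths)
decomposition-∷ {U} {t} {ths} t-thread D = record
  { covers = covers′ ; thread = thread′ ; label-∈ = label-∈′ ; trichotomy = trichotomy′ }
  where
    notIn? = λ p → ¬? (p ∈? t)
    rest⊆ : ∀ {t′ p} → t′ ∈ ths → p ∈ t′ → p ∈ U × p ∉ t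
    rest⊆ t′∈ p∈ with V , V-thread , V⊆ ← thread D t′∈ = ∈-filter⁻ notIn? (V⊆ (⊆U (chain V-thread) p∈))
    covers′ : ∀ {p} → p ∈ U → ∃[ t′ ] (t′ ∈ t ∷ ths × p ∈ t′)
    covers′ {p} p∈ with p ∈? t
    ... | yes p∈t = t , here refl , p∈t
    ... | no p∉t with t′ , t′∈ , p∈t′ ← covers D (∈-filter⁺ notIn? p∈ p∉t) = t′ , there t′∈ , p∈t′
    thread′ : ∀ {t′} → t′ ∈ t ∷ ths → Σ (List Pos) λ V → IsThread V t′ × (∀ {p} → p ∈ V → p ∈ U)
    thread′ (here refl) = U , t-thread , λ p∈ → p∈
    thread′ (there t′∈) with V , V-thread , V⊆ ← thread D t′∈ =
      V , V-thread , λ p∈ → proj₁ (∈-filter⁻ notIn? (V⊆ p∈))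
    label-∈′ : ∀ {t′ p} → t′ ∈ t ∷ ths → p ∈ t′ → label (t ∷ ths) p ≡ col1Row t′
    label-∈′ (here refl) p∈ = label-∷-∈ t ths p∈
    label-∈′ (there t′∈) p∈ = trans (label-∷-∉ t ths (proj₂ (rest⊆ t′∈ p∈))) (label-∈ D t′∈ p∈)
    precedes : ∀ {t′} → t′ ∈ ths → Precedes t t′
    precedes t′∈ = U , t-thread , (λ p∈ → proj₁ (rest⊆ t′∈ p∈)) , (λ p∈ → proj₂ (rest⊆ t′∈ p∈))
    trichotomy′ : ∀ {t₁ t₂} → t₁ ∈ t ∷ ths → t₂ ∈ t ∷ ths → t₁ ≡ t₂ ⊎ Precedes t₁ t₂ ⊎ Precedes t₂ t₁
    trichotomy′ (here refl) (here refl)  = inj₁ refl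
    trichotomy′ (here refl) (there t₂∈)  = inj₂ (inj₁ (precedes t₂∈))
    trichotomy′ (there t₁∈) (here refl)  = inj₂ (inj₂ (precedes t₁∈))
    trichotomy′ (there t₁∈) (there t₂∈) = trichotomy D t₁∈ t₂∈

threadsF-decomposition : ∀ f U → Threadable U → length U ≤ f → IsDecomposition U (threadsF f U)
threadsF-decomposition zero [] _ _ = decomposition-[]
threadsF-decomposition (suc f) U U-ok |U|≤ with lowest (filter (λ p → pcol p ≟ maxCol U) U) in eq
... | nothing =
  record { covers = λ p∈ → ⊥-elim (empty p∈) ; thread = λ () ; label-∈ = λ () ; trichotomy = λ () }
  where
    empty : ∀ {p} → p ∉ U
    empty p∈ with q , q∈ , qc ← maxCol-attained U p∈ =
      lowest-nothing _ eq (∈-filter⁺ (λ p → pcol p ≟ maxCol U) q∈ qc)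
... | just s with s∈′ , s-min ← lowest-minimal _ eq
  with s∈ , sc ← ∈-filter⁻ (λ p → pcol p ≟ maxCol U) {xs = U} s∈′
  = decomposition-∷ t-thread (threadsF-decomposition f _ (removeAll-threadable U-ok t-thread) |U′|≤f)
  where
    t-thread = thread-from (hall U-ok) s∈ (col≥1 U-ok s∈)
      (λ u∈ → subst (_ ≤_) (sym sc) (maxCol-upperBound U u∈))
      (λ u∈ uc → s-min (∈-filter⁺ (λ p → pcol p ≟ maxCol U) u∈ (trans uc sc)))
    |U′|≤f = ≤-pred (≤-trans (filter-notAll (λ p → ¬? (p ∈? _)) U (lose s∈ (λ s∉ → s∉ (here refl)))) |U|≤)

col1Row-∈ : ∀ t {p} → p ∈ t → pcol p ≡ 1 → ∃[ q ] (q ∈ t × pcol q ≡ 1 × col1Row t ≡ prow q)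
col1Row-∈ (x ∷ t) p∈ pc with pcol x ≟ 1
... | yes xc = x , here refl , xc , refl
col1Row-∈ (x ∷ t) (here refl) pc | no x≢1 = ⊥-elim (x≢1 pc)
col1Row-∈ (x ∷ t) (there p∈) pc | no _ with q , q∈ , qc , eq ← col1Row-∈ t p∈ pc = q , there q∈ , qc , eq

module _ {V t : List Pos} (t-thread : IsThread V t) where

  private
    C = chain t-thread

  thread-col≥1 : ∀ {p} → p ∈ t → 1 ≤ pcol p
  thread-col≥1 p∈ = proj₁ (col-bounds C p∈)

  thread-col≤start : ∀ {p} → p ∈ t → pcol p ≤ pcol (start t-thread)
  thread-col≤start p∈ = proj₂ (col-bounds C p∈)

  thread-column1 : ∃[ q ] (q ∈ t × pcol q ≡ 1)
  thread-column1 = cover C 1 ≤-refl (thread-col≥1 (start∈ t-thread))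

  col1Row-≡ : ∀ {p} → p ∈ t → pcol p ≡ 1 → col1Row t ≡ prow p
  col1Row-≡ p∈ pc with q , q∈ , qc , eq ← col1Row-∈ t p∈ pc =
    trans eq (cong prow (col-injective C q∈ p∈ (trans qc (sym pc))))

  thread-descending : ∀ {p q} → p ∈ t → q ∈ t → pcol p ≤ pcol q → prow q ≤ prow p
  thread-descending {p} {q} p∈ q∈ p≤q = descend (pcol q ∸ pcol p) q∈ (sym (m∸n+n≡m p≤q))
    where
      descend : ∀ k {q} → q ∈ t → pcol q ≡ k + pcol p → prow q ≤ prow p
      descend zero q∈ qc = ≤-reflexive (cong prow (col-injective C q∈ p∈ qc))
      descend (suc k) {q} q∈ qc
        with q′ , q′∈ , q′c ← cover C (k + pcol p) (≤-trans (thread-col≥1 p∈) (m≤n+m _ k))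
                                      (≤-trans (n≤1+n _) (subst (_≤ _) qc (thread-col≤start q∈)))
        = ≤-trans (proj₁ (lowestAbove C q′∈ q∈ (trans qc (cong suc (sym q′c))))) (descend k q′∈ q′c)

  row≤col1Row : ∀ {p} → p ∈ t → prow p ≤ col1Row t
  row≤col1Row p∈ with q , q∈ , qc ← thread-column1 =
    subst (_ ≤_) (sym (col1Row-≡ q∈ qc)) (thread-descending q∈ p∈ (subst (_≤ _) (sym qc) (thread-col≥1 p∈)))

-- Threads do not cross

precedes⇒left-below : ∀ {X Y} → Precedes Y X → ∀ {p q q′} → p ∈ X → q ∈ Y → q′ ∈ Y →
                      pcol q ≡ suc (pcol q′) → pcol p ≡ pcol q′ → prow q ≤ prow p → prow q′ < prow p
precedes⇒left-below {Y = Y} (_ , Y-thread , X⊆ , X∩Y=∅) p∈ q∈ q′∈ qc pc q≤p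
  with m≤n⇒m<n∨m≡n (proj₂ (lowestAbove (chain Y-thread) q′∈ q∈ qc) (X⊆ p∈) pc q≤p)
... | inj₁ q′<p = q′<p
... | inj₂ q′≡p = ⊥-elim (X∩Y=∅ p∈ (subst (_∈ Y) (≡-Pos q′≡p (sym pc)) q′∈))

precedes⇒col1Row-< : ∀ {V X Y} → IsThread V X → Precedes Y X → ∀ {p q} → p ∈ X → q ∈ Y →
                     pcol q ≡ pcol p → prow q < prow p → col1Row Y < col1Row X
precedes⇒col1Row-< {X = X} {Y} X-thread Y≺X@(_ , Y-thread , _) {p} p∈ q∈ qc q<p =
  go (pred (pcol p)) p∈ q∈ (sym (suc-pred-≥1 (thread-col≥1 X-thread p∈))) qc q<p
  where
    go : ∀ k {p q} → p ∈ X → q ∈ Y → pcol p ≡ suc k → pcol q ≡ pcol p → prow q < prow p →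
         col1Row Y < col1Row X
    go zero p∈ q∈ pc qc q<p =
      subst₂ _<_ (sym (col1Row-≡ Y-thread q∈ (trans qc pc))) (sym (col1Row-≡ X-thread p∈ pc)) q<p
    go (suc k) {p} {q} p∈ q∈ pc qc q<p
      with p′ , p′∈ , p′c ← cover (chain X-thread) (suc k) (s≤s z≤n)
                              (≤-trans (n≤1+n _) (subst (_≤ _) pc (thread-col≤start X-thread p∈)))
         | q′ , q′∈ , q′c ← cover (chain Y-thread) (suc k) (s≤s z≤n)
                              (≤-trans (n≤1+n _) (subst (_≤ _) (trans qc pc) (thread-col≤start Y-thread q∈)))
      = go k p′∈ q′∈ p′c (trans q′c (sym p′c))
          (precedes⇒left-below Y≺X p′∈ q∈ q′∈ (trans (trans qc pc) (cong suc (sym q′c))) (trans p′c (sym q′c))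
                               (<⇒≤ (<-≤-trans q<p p≤p′)))
      where
        p≤p′ : prow p ≤ prow p′
        p≤p′ = thread-descending X-thread p′∈ p∈ (subst₂ _≤_ (sym p′c) (sym pc) (n≤1+n _))

thread-right-above : ∀ {V X} → IsThread V X → ∀ {p q} → p ∈ X → q ∈ V → pcol q ≡ pcol p → prow q < prow p →
                     ∃[ p′ ] (p′ ∈ X × pcol p′ ≡ suc (pcol p) × prow q < prow p′)
thread-right-above X-thread {p} {q} p∈ q∈ qc q<p with pcol p ≟ pcol (start X-thread)
... | yes p-start = ⊥-elim (<⇒≱ q<p (subst (λ s → prow s ≤ prow q) start≡p start≤q))
  where
    start≡p = col-injective (chain X-thread) (start∈ X-thread) p∈ (sym p-start)
    start≤q = start-lowest X-thread q∈ (trans qc p-start)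
... | no p-not-start
  with p′ , p′∈ , p′c ← cover (chain X-thread) (suc (pcol p)) (s≤s z≤n)
                          (≤∧≢⇒< (thread-col≤start X-thread p∈) p-not-start)
  = p′ , p′∈ , p′c , ≰⇒> (λ p′≤q → <⇒≱ q<p (proj₂ (lowestAbove (chain X-thread) p∈ p′∈ p′c) q∈ qc p′≤q))

precedes⇒col1Row-≢ : ∀ {V X Y} → IsThread V Y → Precedes X Y → col1Row X ≢ col1Row Y
precedes⇒col1Row-≢ Y-thread (_ , X-thread , _ , Y∩X=∅) eq
  with p , p∈ , pc ← thread-column1 X-thread | q , q∈ , qc ← thread-column1 Y-thread
  = Y∩X=∅ q∈ (subst (_∈ _) (≡-Pos row-eq (trans pc (sym qc))) p∈)
  where
    row-eq = trans (sym (col1Row-≡ X-thread p∈ pc)) (trans eq (col1Row-≡ Y-thread q∈ qc))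

-- Relabelling a Kohnert tableau along its threads

at-applyUpTo : (h f : ℕ → ℕ) → ∀ m k → k < m → at (map h (applyUpTo f m)) (suc k) ≡ h (f k)
at-applyUpTo h f (suc m) zero    _         = refl
at-applyUpTo h f (suc m) (suc k) (s≤s k<m) = at-applyUpTo h (λ z → f (suc z)) m k k<m

at-contentOf : ∀ n S {i} → 1 ≤ i → i ≤ n → at (contentOf n S) i ≡ countEnt i S
at-contentOf n S {suc k} _ k<n = at-applyUpTo (λ k → countEnt (suc k) S) (λ z → z) n k k<n

length-contentOf : ∀ n S → length (contentOf n S) ≡ n
length-contentOf n S = trans (length-map _ (upTo n)) (length-applyUpTo _ n)

module _ {a : List ℕ} {T : Filling} (K : IsKT a T) where

  open IsKT K

  private
    D = map pos T
    ths = threads D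
    c = contentOf (length a) (θ T)

  -- Conditions (i) and (iii) match each cell of column j+1 with the weakly higher cell of the
  -- same entry in column j.
  kohnert-hall : Hall D
  kohnert-hall j r 1≤j =
    subst₂ _≤_ (sym (count-map (candidate? (suc j) r) pos T)) (sym (count-map (candidate? j r) pos T))
      (count-≤-matching _≟_ ent (λ x → candidate? (suc j) r (pos x)) (λ x → candidate? j r (pos x))
                        (Unique.map⁻ distinct) same-entry left-match)
    where
      same-entry : ∀ {x y} → x ∈ T → y ∈ T → Candidate (suc j) r (pos x) → Candidate (suc j) r (pos y) →
                   ent x ≡ ent y → x ≡ y
      same-entry x∈ y∈ (xc , _) (yc , _) e = cond-i-uniq _ _ x∈ y∈ e (trans xc (sym yc))
      left-match : ∀ {x} → x ∈ T → Candidate (suc j) r (pos x) →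
                   ∃[ y ] (y ∈ T × Candidate j r (pos y) × ent y ≡ ent x)
      left-match {x} x∈ (xc , r≤x)
        with 1≤e , e≤n ← All.lookup entRange x∈
        with y , y∈ , ye , yc ← cond-i-ex (ent x) j 1≤e e≤n 1≤j
                                  (≤-trans (n≤1+n j) (subst (_≤ at a (ent x)) xc (cond-i-none x x∈)))
        = y , y∈ , (yc , ≤-trans r≤x (cond-iii y x y∈ x∈ ye (≤-reflexive (trans (cong suc yc) (sym xc))))) , ye

  kohnert-decomposition : IsDecomposition D ths
  kohnert-decomposition = threadsF-decomposition (length D) D threadable ≤-refl
    where
      threadable : Threadable D
      threadable = record
        { unique = distinct
        ; col≥1 = λ p∈ → let x , x∈ , p≡ = ∈-map⁻ pos p∈
                         in subst (λ p → 1 ≤ pcol p) (sym p≡) (proj₂ (All.lookup positive x∈))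
        ; hall = kohnert-hall }

  private
    module Decomposition = IsDecomposition kohnert-decomposition

  path⊆D : ∀ {X p} → X ∈ ths → p ∈ X → p ∈ D
  path⊆D X∈ p∈ with _ , X-thread , V⊆ ← Decomposition.thread X∈ = V⊆ (⊆U (chain X-thread) p∈)

  col1Row-injective : ∀ {X Y} → X ∈ ths → Y ∈ ths → col1Row X ≡ col1Row Y → X ≡ Y
  col1Row-injective X∈ Y∈ eq with Decomposition.trichotomy X∈ Y∈
  ... | inj₁ X≡Y        = X≡Y
  ... | inj₂ (inj₁ X≺Y) = ⊥-elim (precedes⇒col1Row-≢ (proj₁ (proj₂ (Decomposition.thread Y∈))) X≺Y eq)
  ... | inj₂ (inj₂ Y≺X) = ⊥-elim (precedes⇒col1Row-≢ (proj₁ (proj₂ (Decomposition.thread X∈))) Y≺X (sym eq))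

  record ThreadThrough (x : Cell) : Set where
    constructor through
    field
      {ambient} : List Pos
      path      : List Pos
      path∈     : path ∈ ths
      pos∈path  : pos x ∈ path
      isThread  : IsThread ambient path
      label≡    : label ths (pos x) ≡ col1Row path

  threadThrough : ∀ {x} → x ∈ T → ThreadThrough x
  threadThrough x∈ with X , X∈ , p∈ ← Decomposition.covers (∈-map⁺ pos x∈) =
    through X X∈ p∈ (proj₁ (proj₂ (Decomposition.thread X∈))) (Decomposition.label-∈ X∈ p∈)

  ∈-path-labelled : ∀ {X x} → X ∈ ths → x ∈ T → label ths (pos x) ≡ col1Row X → pos x ∈ X
  ∈-path-labelled X∈ x∈ eq with through Y Y∈ p∈ _ label≡ ← threadThrough x∈ =
    subst (_ ∈_) (col1Row-injective Y∈ X∈ (trans (sym label≡) eq)) p∈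

  cellAt : Pos → Cell
  cellAt p = cell (prow p) (pcol p) (label ths p)

  θ-∈⁻ : ∀ {z} → z ∈ θ T → ∃[ x ] (x ∈ T × z ≡ cellAt (pos x))
  θ-∈⁻ = ∈-map⁻ (λ x → cellAt (pos x))

  θ-∈⁺ : ∀ {x} → x ∈ T → cellAt (pos x) ∈ θ T
  θ-∈⁺ = ∈-map⁺ (λ x → cellAt (pos x))

  θ-distinct : Unique (map pos (θ T))
  θ-distinct = subst Unique (map-∘ T) distinct

  label-column1 : ∀ {x} → x ∈ T → ∃[ y ] (y ∈ T × label ths (pos x) ≡ row y)
  label-column1 x∈ with through X X∈ _ X-thread label≡ ← threadThrough x∈
                  with q , q∈ , qc ← thread-column1 X-thread
                  with y , y∈ , refl ← ∈-map⁻ pos (path⊆D X∈ q∈)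
    = y , y∈ , trans label≡ (col1Row-≡ X-thread q∈ qc)

  label-bounds : ∀ {x} → x ∈ T → 1 ≤ label ths (pos x) × label ths (pos x) ≤ length a
  label-bounds x∈ with y , y∈ , eq ← label-column1 x∈ =
    subst (1 ≤_) (sym eq) (proj₁ (All.lookup positive y∈)) ,
    subst (_≤ length a) (sym eq) (≤-trans (All.lookup cond-ii y∈) (proj₂ (All.lookup entRange y∈)))

  row≤label : ∀ {x} → x ∈ T → row x ≤ label ths (pos x)
  row≤label {x} x∈ with through _ _ p∈ X-thread label≡ ← threadThrough x∈ =
    subst (row x ≤_) (sym label≡) (row≤col1Row X-thread p∈)

  labelled : ℕ → List Cell
  labelled i = filter (λ z → ent z ≟ i) (θ T)

  labelled-∈⁻ : ∀ {X z} → X ∈ ths → z ∈ labelled (col1Row X) →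
                ∃[ x ] (x ∈ T × z ≡ cellAt (pos x) × pos x ∈ X)
  labelled-∈⁻ X∈ z∈ with z∈θ , ze ← ∈-filter⁻ (λ z → ent z ≟ _) {xs = θ T} z∈
                    with x , x∈ , refl ← θ-∈⁻ z∈θ
    = x , x∈ , refl , ∈-path-labelled X∈ x∈ ze

  thread-size : ∀ {V X} → X ∈ ths → (X-thread : IsThread V X) →
                length (labelled (col1Row X)) ≡ pcol (start X-thread)
  thread-size {X = X} X∈ X-thread =
    trans (sym (length-map col (labelled (col1Row X)))) (length≡-range cols-unique cols⊆ ⊆cols)
    where
      C = chain X-thread
      col-injectiveOn : ∀ {z w} → z ∈ labelled (col1Row X) → w ∈ labelled (col1Row X) → col z ≡ col w → z ≡ w
      col-injectiveOn z∈ w∈ e with _ , _ , refl , px ← labelled-∈⁻ X∈ z∈ | _ , _ , refl , py ← labelled-∈⁻ X∈ w∈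
        = cong cellAt (col-injective C px py e)
      cols-unique : Unique (map col (labelled (col1Row X)))
      cols-unique = Unique-map-injectiveOn col (Unique.filter⁺ _ (Unique.map⁻ θ-distinct)) col-injectiveOn
      cols⊆ : ∀ {k} → k ∈ map col (labelled (col1Row X)) → 1 ≤ k × k ≤ pcol (start X-thread)
      cols⊆ k∈ with z , z∈ , refl ← ∈-map⁻ col k∈ with _ , _ , refl , px ← labelled-∈⁻ X∈ z∈ =
        col-bounds C px
      ⊆cols : ∀ k → 1 ≤ k → k ≤ pcol (start X-thread) → k ∈ map col (labelled (col1Row X))
      ⊆cols k 1≤k k≤s with p , p∈ , refl ← cover C k 1≤k k≤s
                      with y , y∈ , refl ← ∈-map⁻ pos (path⊆D X∈ p∈) =
        ∈-map⁺ col (∈-filter⁺ (λ z → ent z ≟ col1Row X) (θ-∈⁺ y∈) (Decomposition.label-∈ X∈ p∈))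

  content-at-label : ∀ {x V X} → x ∈ T → X ∈ ths → (X-thread : IsThread V X) →
                     label ths (pos x) ≡ col1Row X →
                     at c (label ths (pos x)) ≡ pcol (start X-thread)
  content-at-label x∈ X∈ X-thread label≡ with 1≤l , l≤n ← label-bounds x∈ =
    trans (at-contentOf (length a) (θ T) 1≤l l≤n)
          (trans (cong (λ i → length (labelled i)) label≡) (thread-size X∈ X-thread))

  θ-cond-i-ex : ∀ i k → 1 ≤ i → i ≤ length c → 1 ≤ k → k ≤ at c i → ∃[ z ] (z ∈ θ T × ent z ≡ i × col z ≡ k)
  θ-cond-i-ex i k 1≤i i≤|c| 1≤k k≤cᵢ
    with cᵢ≡ ← at-contentOf (length a) (θ T) 1≤i (subst (i ≤_) (length-contentOf (length a) (θ T)) i≤|c|)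
    with z , z∈ ← ∈-of-length≥1 (≤-trans 1≤k (subst (k ≤_) cᵢ≡ k≤cᵢ))
    with z∈θ , refl ← ∈-filter⁻ (λ z → ent z ≟ i) {xs = θ T} z∈
    with x , x∈ , refl ← θ-∈⁻ z∈θ
    with through _ X∈ _ X-thread label≡ ← threadThrough x∈
    with p , p∈ , refl ← cover (chain X-thread) k 1≤k
                                (subst (k ≤_) (content-at-label x∈ X∈ X-thread label≡) k≤cᵢ)
    with y , y∈ , refl ← ∈-map⁻ pos (path⊆D X∈ p∈)
    = cellAt (pos y) , θ-∈⁺ y∈ , trans (Decomposition.label-∈ X∈ p∈) (sym label≡) , refl

  θ-cond-i-uniq : ∀ z w → z ∈ θ T → w ∈ θ T → ent z ≡ ent w → col z ≡ col w → z ≡ w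
  θ-cond-i-uniq _ _ z∈ w∈ e ce with x , x∈ , refl ← θ-∈⁻ z∈ | y , y∈ , refl ← θ-∈⁻ w∈
    with through Y Y∈ py Y-thread label≡ ← threadThrough y∈
    = cong cellAt (col-injective (chain Y-thread) (∈-path-labelled Y∈ x∈ (trans e label≡)) py ce)

  θ-cond-i-none : ∀ z → z ∈ θ T → col z ≤ at c (ent z)
  θ-cond-i-none _ z∈ with x , x∈ , refl ← θ-∈⁻ z∈ with through _ X∈ px X-thread label≡ ← threadThrough x∈ =
    subst (col x ≤_) (sym (content-at-label x∈ X∈ X-thread label≡)) (thread-col≤start X-thread px)

  θ-cond-iii : ∀ z w → z ∈ θ T → w ∈ θ T → ent z ≡ ent w → col z < col w → row w ≤ row z
  θ-cond-iii _ _ z∈ w∈ e lt with x , x∈ , refl ← θ-∈⁻ z∈ | y , y∈ , refl ← θ-∈⁻ w∈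
    with through Y Y∈ py Y-thread label≡ ← threadThrough y∈
    = thread-descending Y-thread (∈-path-labelled Y∈ x∈ (trans e label≡)) py (<⇒≤ lt)

  θ-cond-iv : ∀ z w → z ∈ θ T → w ∈ θ T → col z ≡ col w → ent z < ent w → row w < row z →
              ∃[ u ] (u ∈ θ T × ent u ≡ ent z × col u ≡ suc (col z) × row w < row u)
  θ-cond-iv _ _ z∈ w∈ ce lt w<z with x , x∈ , refl ← θ-∈⁻ z∈ | y , y∈ , refl ← θ-∈⁻ w∈
    with through X X∈ px X-thread lx ← threadThrough x∈ | through Y Y∈ py Y-thread ly ← threadThrough y∈
    with Decomposition.trichotomy X∈ Y∈
  ... | inj₁ refl = ⊥-elim (<-irrefl (trans lx (sym ly)) lt)
  ... | inj₂ (inj₂ Y≺X) =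
    ⊥-elim (<-asym lt (subst₂ _<_ (sym ly) (sym lx) (precedes⇒col1Row-< X-thread Y≺X px py (sym ce) w<z)))
  ... | inj₂ (inj₁ (_ , X-thread′ , Y⊆ , _))
    with p′ , p′∈ , p′c , y<p′ ← thread-right-above X-thread′ px (Y⊆ py) (sym ce) w<z
    with x′ , x′∈ , refl ← ∈-map⁻ pos (path⊆D X∈ p′∈)
    = cellAt (pos x′) , θ-∈⁺ x′∈ , trans (Decomposition.label-∈ X∈ p′∈) (sym lx) , p′c , y<p′

  θ-cond-v : ∀ z w → z ∈ θ T → w ∈ θ T → col z ≡ 1 → col w ≡ 1 → row z < row w → ent z < ent w
  θ-cond-v _ _ z∈ w∈ zc wc lt with x , x∈ , refl ← θ-∈⁻ z∈ | y , y∈ , refl ← θ-∈⁻ w∈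
    with through _ _ px X-thread lx ← threadThrough x∈ | through _ _ py Y-thread ly ← threadThrough y∈
    = subst₂ _<_ (sym (trans lx (col1Row-≡ X-thread px zc))) (sym (trans ly (col1Row-≡ Y-thread py wc))) lt

  θ-cond-vi : ∀ z w → z ∈ θ T → w ∈ θ T → ent z < ent w → col w ≡ suc (col z) → row w ≤ row z →
              at c (ent w) ≤ at c (ent z)
  θ-cond-vi _ _ z∈ w∈ lt ce w≤z with x , x∈ , refl ← θ-∈⁻ z∈ | y , y∈ , refl ← θ-∈⁻ w∈
    with through _ X∈ px X-thread lx ← threadThrough x∈ | through _ Y∈ py Y-thread ly ← threadThrough y∈
    with Decomposition.trichotomy X∈ Y∈
  ... | inj₁ refl = ⊥-elim (<-irrefl (trans lx (sym ly)) lt)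
  ... | inj₂ (inj₁ (_ , X-thread′ , Y⊆ , _)) =
    subst₂ _≤_ (sym (content-at-label y∈ Y∈ Y-thread ly)) (sym (content-at-label x∈ X∈ X-thread′ lx))
           (start-max X-thread′ (Y⊆ (start∈ Y-thread)))
  ... | inj₂ (inj₂ Y≺X@(_ , Y-thread′ , _))
    with y′ , y′∈ , y′c ← cover (chain Y-thread′) (col x) (proj₂ (All.lookup positive x∈))
                            (≤-trans (n≤1+n _) (subst (_≤ _) ce (thread-col≤start Y-thread′ py)))
    = ⊥-elim (<-asym lt (subst₂ _<_ (sym ly) (sym lx)
        (precedes⇒col1Row-< X-thread Y≺X px y′∈ y′c
           (precedes⇒left-below Y≺X px py y′∈ (trans ce (cong suc (sym y′c))) (sym y′c) w≤z))))

  θ-isKT : IsKT c (θ T)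
  θ-isKT = record
    { distinct    = θ-distinct
    ; positive    = All.map⁺ positive
    ; entRange    = All.map⁺ (All.tabulate λ x∈ →
                      let 1≤l , l≤n = label-bounds x∈
                      in 1≤l , subst (_ ≤_) (sym (length-contentOf (length a) (θ T))) l≤n)
    ; cond-i-ex   = θ-cond-i-ex
    ; cond-i-uniq = θ-cond-i-uniq
    ; cond-i-none = θ-cond-i-none
    ; cond-ii     = All.map⁺ (All.tabulate row≤label)
    ; cond-iii    = θ-cond-iii
    ; cond-iv     = θ-cond-iv }

  θ-isQKT : IsQKT c (θ T)
  θ-isQKT = record { isKT = θ-isKT ; cond-v = θ-cond-v ; cond-vi = θ-cond-vi }

lemma3p6 : (a : List ℕ) (T : Filling) → IsKT a T →
    IsQKT (contentOf (length a) (θ T)) (θ T)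
lemma3p6 a T K = θ-isQKT K
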